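{- Let $p$ be the partially ordered pattern of length 4 whose occurrences in a permutation $\pi=\pi_1\cdots\pi_n$ are the subsequences $\pi_{i_1}\pi_{i_2}\pi_{i_3}\pi_{i_4}$ with $i_1<i_2<i_3<i_4$ such that $\pi_{i_1}<\pi_{i_4}$, $\pi_{i_3}<\pi_{i_4}$ and $\pi_{i_3}<\pi_{i_2}$. Let $a(n)$ be the number of permutations of $[n]$ avoiding $p$. Then $a(0)=a(1)=1$ and $a(n)=4a(n-1)-3a(n-2)+1$ for $n\geq 2$; consequently $a(n)=\frac{3^n-2n+3}{4}$ for all $n\ge 0$ and $$\sum_{n\geq 0}a(n)x^n=\frac{(1-2x)^2}{(1-3x)(1-x)^2}.$$
   Context: A permutation avoids a pattern if it contains no occurrence of it; the empty permutation counts for $n=0$. -}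

module Defs where

open import Data.Nat using (ℕ; zero; suc; _<_; _∸_)
open import Data.Fin using (Fin; toℕ)
import Data.Fin as F
open import Data.Integer as ℤ using (ℤ)
open import Data.List using (List; _∷_; []; length; lookup; applyUpTo; upTo; map; foldr)
open import Data.List.Relation.Binary.Permutation.Propositional using (_↭_)
open import Data.List.Relation.Unary.Unique.Propositional using (Unique)
open import Data.List.Membership.Propositional using (_∈_)
open import Data.Product using (Σ; ∃; _×_)
open import Relation.Nullary using (¬_)
open import Function.Bundles using (_⇔_)

[_] : ℕ → List ℕ
[ n ] = applyUpTo suc n

IsPerm : ℕ → List ℕ → Set
IsPerm n π = π ↭ [ n ]

Occurrence : List ℕ → Set
Occurrence π =
  Σ (Fin (length π)) λ i₁ → Σ (Fin (length π)) λ i₂ →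
  Σ (Fin (length π)) λ i₃ → Σ (Fin (length π)) λ i₄ →
  (i₁ F.< i₂) × (i₂ F.< i₃) × (i₃ F.< i₄) ×
  (lookup π i₁ < lookup π i₄) × (lookup π i₃ < lookup π i₄) ×
  (lookup π i₃ < lookup π i₂)

Avoids : List ℕ → Set
Avoids π = ¬ Occurrence π

-- L is a duplicate-free list of exactly the p-avoiding permutations of [n]
-- (so  length L  is the number of such permutations)
ListsAvoiders : ℕ → List (List ℕ) → Set
ListsAvoiders n L = Unique L × (∀ π → (π ∈ L) ⇔ (IsPerm n π × Avoids π))

Series : Set
Series = ℕ → ℤ

_⊛_ : Series → Series → Series
(f ⊛ g) n = foldr ℤ._+_ (ℤ.+ 0) (map (λ k → f k ℤ.* g (n ∸ k)) (upTo (suc n)))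

poly : List ℤ → Series
poly []     n       = ℤ.+ 0
poly (c ∷ cs) zero    = c
poly (c ∷ cs) (suc n) = poly cs n

-- Write an arrangement of a set of naturals as γ m δ with m its minimum. It avoids the
-- pattern iff γ avoids it, δ has no valley (no entry with larger entries on both sides)
-- and every entry of δ lies below every entry of γ except the last one. Such pairs
-- (γ , δ) are generated by placing the successive minima of the remaining set, which can
-- only go to an end of δ or to the end of γ. Counting the resulting duplicate-free
-- enumerations gives a(n+1) = a(n) + s(n) with s(n+1) = 3 s(n) + 1, hence
-- a(n+2) + 3 a(n) = 4 a(n+1) + 1; the closed form and the generating function follow
-- from this recurrence and a(0) = a(1) = 1.

module Submission where

open import Defs
open import Data.Nat as ℕ using (ℕ; zero; suc; _<_; _≤_; z≤n; s≤s; s<s⁻¹)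
open import Data.Nat.Properties using (<-irrefl; <-asym; <-≤-trans; <⇒≤; ≮⇒≥; +-cancelʳ-≡)
import Data.Nat.Tactic.RingSolver as ℕ-Solver
open import Data.Integer as ℤ using (ℤ; +_; -[1+_])
import Data.Integer.Properties as ℤ
import Data.Integer.Tactic.RingSolver as ℤ-Solver
open import Data.Fin as F using (Fin; zero; suc)
open import Data.Maybe using (just)
open import Data.Product using (Σ; ∃; ∃₂; _×_; _,_; proj₁; proj₂)
open import Data.Sum using (_⊎_; inj₁; inj₂)
open import Data.Empty using (⊥; ⊥-elim)
import Data.List as List
open import Data.List
  using (List; []; _∷_; _++_; length; lookup; map; head; foldr; applyUpTo)
open import Data.List.Properties
  using ( length-map; length-++; length-applyUpTo; map-∘; ++-assoc; ++-identityʳ; ++-conicalʳ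
        ; ∷-injective; ∷ʳ-injectiveˡ)
open import Data.List.Membership.Propositional using (_∈_; _∉_)
open import Data.List.Membership.Propositional.Properties
  using (∈-map⁺; ∈-++⁺ˡ; ∈-++⁺ʳ; ∈-++⁻; ∈-∃++)
open import Data.List.Membership.Propositional.Properties.WithK using (unique∧set⇒bag)
open import Data.List.Relation.Unary.Any using (here; there)
open import Data.List.Relation.Unary.All as All using (All; []; _∷_)
import Data.List.Relation.Unary.All.Properties as All
open import Data.List.Relation.Unary.AllPairs using (AllPairs; []; _∷_)
import Data.List.Relation.Unary.AllPairs.Properties as AllPairs
open import Data.List.Relation.Unary.Linked as Linked using (Linked; []; [-]; _∷_)
import Data.List.Relation.Unary.Linked.Properties as Linked
open import Data.List.Relation.Unary.Unique.Propositional using (Unique)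
import Data.List.Relation.Unary.Unique.Propositional.Properties as Unique
open import Data.List.Relation.Binary.Disjoint.Propositional using (Disjoint)
open import Data.List.Relation.Binary.BagAndSetEquality using (∼bag⇒↭)
open import Data.List.Relation.Binary.Permutation.Propositional
  using (_↭_; ↭-refl; ↭-sym; ↭-trans; ↭-reflexive; prep)
open import Data.List.Relation.Binary.Permutation.Propositional.Properties
  using (shift; drop-mid; All-resp-↭; ∈-resp-↭; ↭-empty-inv; ↭-length)
open import Data.List.Relation.Binary.Sublist.Propositional
  using (_⊆_; []; _∷_; _∷ʳ_; minimum; ⊆-trans; ⊆-refl; to∈; from∈)
open import Data.List.Relation.Binary.Sublist.Propositional.Properties
  using (++⁺; ++⁺ˡ; ++⁺ʳ; ∷ˡ⁻; ∷⁻)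
open import Function using (_∘_; case_of_)
open import Function.Construct.Composition using (_⇔-∘_)
open import Function.Construct.Symmetry using (⇔-sym)
open import Function.Bundles using (_⇔_; mk⇔)
open import Relation.Nullary using (¬_)
open import Relation.Binary.PropositionalEquality
  using (_≡_; _≢_; refl; sym; trans; cong; cong₂; subst; module ≡-Reasoning)

open ≡-Reasoning

module _ (p q : ℕ) where
  open import Data.Nat using (_+_; _*_)

  SatisfiesRec : (ℕ → ℕ) → Set
  SatisfiesRec u = ∀ n → u (suc (suc n)) + p * u n ≡ q * u (suc n)

  satisfiesRec-unique : ∀ {u v} → SatisfiesRec u → SatisfiesRec v → u 0 ≡ v 0 → u 1 ≡ v 1 →
    ∀ n → u n ≡ v n
  satisfiesRec-unique {u} {v} ru rv u₀ u₁ n = proj₁ (consecutive n)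
    where
    consecutive : ∀ n → u n ≡ v n × u (suc n) ≡ v (suc n)
    consecutive zero    = u₀ , u₁
    consecutive (suc n) with consecutive n
    ... | uₙ≡vₙ , uₙ₊₁≡vₙ₊₁ = uₙ₊₁≡vₙ₊₁ , +-cancelʳ-≡ (p * u n) _ _ (begin
      u (suc (suc n)) + p * u n ≡⟨ ru n ⟩
      q * u (suc n)             ≡⟨ cong (q *_) uₙ₊₁≡vₙ₊₁ ⟩
      q * v (suc n)             ≡⟨ rv n ⟨
      v (suc (suc n)) + p * v n ≡⟨ cong (λ w → v (suc (suc n)) + p * w) uₙ≡vₙ ⟨
      v (suc (suc n)) + p * u n ∎)

module _ where
  open import Data.Nat using (_+_; _*_; _^_)

  private
    scaled-step : ∀ x y z n → x + 3 * z ≡ 4 * y + 1 →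
      (4 * x + 2 * suc (suc n)) + 3 * (4 * z + 2 * n) ≡ 4 * (4 * y + 2 * suc n)
    scaled-step x y z n eq = begin
      (4 * x + 2 * suc (suc n)) + 3 * (4 * z + 2 * n) ≡⟨ ℕ-Solver.solve (x List.∷ z List.∷ n List.∷ List.[]) ⟩
      4 * (x + 3 * z) + 8 * n + 4                     ≡⟨ cong (λ w → 4 * w + 8 * n + 4) eq ⟩
      4 * (4 * y + 1) + 8 * n + 4                     ≡⟨ ℕ-Solver.solve (y List.∷ n List.∷ List.[]) ⟩
      4 * (4 * y + 2 * suc n)                         ∎

    power-step : ∀ x → 3 * (3 * x) + 3 + 3 * (x + 3) ≡ 4 * (3 * x + 3)
    power-step = ℕ-Solver.solve-∀

  closed-form : ∀ {a : ℕ → ℕ} → a 0 ≡ 1 → a 1 ≡ 1 → (∀ n → a (suc (suc n)) + 3 * a n ≡ 4 * a (suc n) + 1) →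
    ∀ n → 4 * a n + 2 * n ≡ 3 ^ n + 3
  closed-form {a} a₀ a₁ rec =
    satisfiesRec-unique 3 4 {λ n → 4 * a n + 2 * n} {λ n → 3 ^ n + 3}
      (λ n → scaled-step (a (suc (suc n))) (a (suc n)) (a n) n (rec n))
      (λ n → power-step (3 ^ n))
      (cong (λ x → 4 * x + 0) a₀) (cong (λ x → 4 * x + 2) a₁)

module _ where
  open import Data.Integer using (_+_; _*_; -_)

  private
    foldr-zeros : ∀ (g : ℕ → ℤ) h n → (∀ k → g (h k) ≡ + 0) → foldr _+_ (+ 0) (map g (applyUpTo h n)) ≡ + 0
    foldr-zeros g h zero    _  = refl
    foldr-zeros g h (suc n) g0 = cong₂ _+_ (g0 0) (foldr-zeros g (λ k → h (suc k)) n (λ k → g0 (suc k)))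

  linear-⊛ : ∀ c₀ c₁ (f : Series) n → (poly (c₀ ∷ c₁ ∷ []) ⊛ f) (suc n) ≡ c₀ * f (suc n) + c₁ * f n
  linear-⊛ c₀ c₁ f n = trans
    (cong (λ r → c₀ * f (suc n) + (c₁ * f n + r)) (foldr-zeros _ _ n (λ _ → refl)))
    (cong (λ r → c₀ * f (suc n) + r) (ℤ.+-identityʳ (c₁ * f n)))

  private
    difference-step : ∀ x₀ x₁ x₂ → x₂ + + 3 * x₀ ≡ + 4 * x₁ + + 1 →
      + 1 * x₂ + - + 1 * x₁ ≡ + 3 * (+ 1 * x₁ + - + 1 * x₀) + + 1
    difference-step x₀ x₁ x₂ eq = begin
      + 1 * x₂ + - + 1 * x₁                 ≡⟨ ℤ-Solver.solve (x₀ List.∷ x₁ List.∷ x₂ List.∷ List.[]) ⟩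
      (x₂ + + 3 * x₀) + - (+ 3 * x₀ + x₁)   ≡⟨ cong (λ w → w + - (+ 3 * x₀ + x₁)) eq ⟩
      (+ 4 * x₁ + + 1) + - (+ 3 * x₀ + x₁)  ≡⟨ ℤ-Solver.solve (x₀ List.∷ x₁ List.∷ List.[]) ⟩
      + 3 * (+ 1 * x₁ + - + 1 * x₀) + + 1   ∎

    difference-of-affine : ∀ x y → + 1 * (+ 3 * x + + 1) + - + 1 * (+ 3 * y + + 1) ≡ + 3 * (+ 1 * x + - + 1 * y)
    difference-of-affine = ℤ-Solver.solve-∀

    multiple-cancels : ∀ x → + 1 * (+ 3 * x) + - + 3 * x ≡ + 0
    multiple-cancels = ℤ-Solver.solve-∀

  module _ {a : ℕ → ℕ} (rec : ∀ n → a (suc (suc n)) ℕ.+ 3 ℕ.* a n ≡ 4 ℕ.* a (suc n) ℕ.+ 1) where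

    private
      A B C : Series
      A n = + a n
      B = poly (+ 1 ∷ -[1+ 0 ] ∷ []) ⊛ A
      C = poly (+ 1 ∷ -[1+ 0 ] ∷ []) ⊛ B

      rec-ℤ : ∀ n → A (suc (suc n)) + + 3 * A n ≡ + 4 * A (suc n) + + 1
      rec-ℤ n = begin
        + a (suc (suc n)) + + 3 * + a n     ≡⟨ cong (λ w → + a (suc (suc n)) + w) (ℤ.pos-* 3 (a n)) ⟨
        + a (suc (suc n)) + + (3 ℕ.* a n)   ≡⟨ ℤ.pos-+ (a (suc (suc n))) _ ⟨
        + (a (suc (suc n)) ℕ.+ 3 ℕ.* a n)   ≡⟨ cong +_ (rec n) ⟩
        + (4 ℕ.* a (suc n) ℕ.+ 1)           ≡⟨ ℤ.pos-+ (4 ℕ.* a (suc n)) 1 ⟩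
        + (4 ℕ.* a (suc n)) + + 1           ≡⟨ cong (_+ + 1) (ℤ.pos-* 4 (a (suc n))) ⟩
        + 4 * + a (suc n) + + 1             ∎

      B-rec : ∀ n → B (suc (suc n)) ≡ + 3 * B (suc n) + + 1
      B-rec n = begin
        B (suc (suc n))                                 ≡⟨ linear-⊛ (+ 1) -[1+ 0 ] A (suc n) ⟩
        + 1 * A (suc (suc n)) + - + 1 * A (suc n)
          ≡⟨ difference-step (A n) (A (suc n)) (A (suc (suc n))) (rec-ℤ n) ⟩
        + 3 * (+ 1 * A (suc n) + - + 1 * A n) + + 1
          ≡⟨ cong (λ w → + 3 * w + + 1) (linear-⊛ (+ 1) -[1+ 0 ] A n) ⟨
        + 3 * B (suc n) + + 1                           ∎

      C-rec : ∀ n → C (suc (suc (suc n))) ≡ + 3 * C (suc (suc n))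
      C-rec n = begin
        C (suc (suc (suc n)))                           ≡⟨ linear-⊛ (+ 1) -[1+ 0 ] B (suc (suc n)) ⟩
        + 1 * B (suc (suc (suc n))) + - + 1 * B (suc (suc n))
          ≡⟨ cong₂ (λ u v → + 1 * u + - + 1 * v) (B-rec (suc n)) (B-rec n) ⟩
        + 1 * (+ 3 * B (suc (suc n)) + + 1) + - + 1 * (+ 3 * B (suc n) + + 1)
          ≡⟨ difference-of-affine (B (suc (suc n))) (B (suc n)) ⟩
        + 3 * (+ 1 * B (suc (suc n)) + - + 1 * B (suc n))
          ≡⟨ cong (+ 3 *_) (linear-⊛ (+ 1) -[1+ 0 ] B (suc n)) ⟨
        + 3 * C (suc (suc n))                           ∎

    third-difference-vanishes : ∀ n →
      (poly (+ 1 ∷ -[1+ 2 ] ∷ []) ⊛ (poly (+ 1 ∷ -[1+ 0 ] ∷ []) ⊛ (poly (+ 1 ∷ -[1+ 0 ] ∷ []) ⊛ (λ n → + a n))))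
        (suc (suc (suc n)))
      ≡ + 0
    third-difference-vanishes n = begin
      (poly (+ 1 ∷ -[1+ 2 ] ∷ []) ⊛ C) (suc (suc (suc n)))  ≡⟨ linear-⊛ (+ 1) -[1+ 2 ] C (suc (suc n)) ⟩
      + 1 * C (suc (suc (suc n))) + - + 3 * C (suc (suc n))
        ≡⟨ cong (λ u → + 1 * u + - + 3 * C (suc (suc n))) (C-rec n) ⟩
      + 1 * (+ 3 * C (suc (suc n))) + - + 3 * C (suc (suc n)) ≡⟨ multiple-cancels (C (suc (suc n))) ⟩
      + 0                                                   ∎

module _ {A : Set} where

  ⊆⇒indices : {xs ys : List A} → xs ⊆ ys →
    ∃ λ (is : List (Fin (length ys))) → Linked F._<_ is × map (lookup ys) is ≡ xs
  ⊆⇒indices [] = [] , [] , refl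
  ⊆⇒indices (y ∷ʳ xs⊆ys) with ⊆⇒indices xs⊆ys
  ... | is , is↗ , refl = map suc is , Linked.map⁺ (Linked.map s≤s is↗) , sym (map-∘ is)
  ⊆⇒indices (refl ∷ xs⊆ys) with ⊆⇒indices xs⊆ys
  ... | is , is↗ , refl =
    zero ∷ map suc is , zero-∷ is (Linked.map⁺ (Linked.map s≤s is↗)) , cong (_ ∷_) (sym (map-∘ is))
    where
    zero-∷ : ∀ {n} (is : List (Fin n)) → Linked F._<_ (map suc is) → Linked F._<_ (zero ∷ map suc is)
    zero-∷ []      _   = [-]
    zero-∷ (_ ∷ _) is↗ = s≤s z≤n ∷ is↗

  private
    above⇒suc : ∀ {n} {i : Fin (suc n)} {is} → Linked F._<_ (i ∷ is) → ∃ λ js → is ≡ map suc js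
    above⇒suc [-] = [] , refl
    above⇒suc (_∷_ {y = suc j} _ is↗) with above⇒suc is↗
    ... | js , refl = j ∷ js , refl

    lower : ∀ {n} {is : List (Fin n)} → Linked F._<_ (map suc is) → Linked F._<_ is
    lower is↗ = Linked.map s<s⁻¹ (Linked.map⁻ is↗)

  indices⇒⊆ : (ys : List A) {is : List (Fin (length ys))} → Linked F._<_ is → map (lookup ys) is ⊆ ys
  indices⇒⊆ []       {[]}         _   = []
  indices⇒⊆ (y ∷ ys) {[]}         _   = minimum _
  indices⇒⊆ (y ∷ ys) {zero ∷ is}  is↗ with above⇒suc is↗
  ... | js , refl = refl ∷ subst (_⊆ ys) (map-∘ js) (indices⇒⊆ ys (lower (Linked.tail is↗)))
  indices⇒⊆ (y ∷ ys) {suc i ∷ is} is↗ with above⇒suc is↗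
  ... | js , refl = y ∷ʳ subst (_⊆ ys) (map-∘ (i ∷ js)) (indices⇒⊆ ys {i ∷ js} (lower is↗))

  split-⊆-++ : ∀ {xs} ys {zs} → xs ⊆ ys ++ zs → ∃₂ λ (as bs : List A) → xs ≡ as ++ bs × as ⊆ ys × bs ⊆ zs
  split-⊆-++ []       xs⊆zs = [] , _ , refl , [] , xs⊆zs
  split-⊆-++ (y ∷ ys) (.y ∷ʳ xs⊆) with split-⊆-++ ys xs⊆
  ... | as , bs , refl , as⊆ , bs⊆ = as , bs , refl , y ∷ʳ as⊆ , bs⊆
  split-⊆-++ (y ∷ ys) (refl ∷ xs⊆) with split-⊆-++ ys xs⊆
  ... | as , bs , refl , as⊆ , bs⊆ = y ∷ as , bs , refl , refl ∷ as⊆ , bs⊆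

Occurrence⊆ : List ℕ → Set
Occurrence⊆ π = ∃₂ λ w x → ∃₂ λ y z →
  w ∷ x ∷ y ∷ z ∷ [] ⊆ π × w < z × y < z × y < x

Avoids⊆ : List ℕ → Set
Avoids⊆ π = ¬ Occurrence⊆ π

occurrence⇒occurrence⊆ : ∀ {π} → Occurrence π → Occurrence⊆ π
occurrence⇒occurrence⊆ {π} (i₁ , i₂ , i₃ , i₄ , i₁<i₂ , i₂<i₃ , i₃<i₄ , p) =
  _ , _ , _ , _ , indices⇒⊆ π (i₁<i₂ ∷ i₂<i₃ ∷ i₃<i₄ ∷ [-]) , p

occurrence⊆⇒occurrence : ∀ {π} → Occurrence⊆ π → Occurrence π
occurrence⊆⇒occurrence (w , x , y , z , wxyz⊆π , p) with ⊆⇒indices wxyz⊆π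
... | i₁ ∷ i₂ ∷ i₃ ∷ i₄ ∷ [] , i₁<i₂ ∷ i₂<i₃ ∷ i₃<i₄ ∷ [-] , refl =
  i₁ , i₂ , i₃ , i₄ , i₁<i₂ , i₂<i₃ , i₃<i₄ , p
... | [] , _ , ()
... | _ ∷ [] , _ , ()
... | _ ∷ _ ∷ [] , _ , ()
... | _ ∷ _ ∷ _ ∷ [] , _ , ()
... | _ ∷ _ ∷ _ ∷ _ ∷ _ ∷ _ , _ , ()

avoids⇒avoids⊆ : ∀ {π} → Avoids π → Avoids⊆ π
avoids⇒avoids⊆ av = av ∘ occurrence⊆⇒occurrence

avoids⊆⇒avoids : ∀ {π} → Avoids⊆ π → Avoids π
avoids⊆⇒avoids av = av ∘ occurrence⇒occurrence⊆

Valley : List ℕ → Set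
Valley δ = ∃₂ λ x y → ∃ λ z → x ∷ y ∷ z ∷ [] ⊆ δ × y < x × y < z

ValleyFree : List ℕ → Set
ValleyFree δ = ¬ Valley δ

-- w ranges over the entries of γ other than its last.
BelowInit : List ℕ → List ℕ → Set
BelowInit δ γ = ∀ {w x} → w ∷ x ∷ [] ⊆ γ → All (_≤ w) δ

BelowAll : List ℕ → List ℕ → Set
BelowAll δ γ = ∀ {w} → w ∈ γ → All (_≤ w) δ

avoids⊆-mono : ∀ {π π′} → π ⊆ π′ → Avoids⊆ π′ → Avoids⊆ π
avoids⊆-mono π⊆π′ av (w , x , y , z , o , p) = av (w , x , y , z , ⊆-trans o π⊆π′ , p)

valleyFree-mono : ∀ {δ δ′} → δ ⊆ δ′ → ValleyFree δ′ → ValleyFree δ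
valleyFree-mono δ⊆δ′ vf (x , y , z , v , p) = vf (x , y , z , ⊆-trans v δ⊆δ′ , p)

avoids⊆-[] : Avoids⊆ []
avoids⊆-[] (_ , _ , _ , _ , () , _)

valleyFree-[] : ValleyFree []
valleyFree-[] (_ , _ , _ , () , _)

module _ {m : ℕ} {γ δ : List ℕ} (m<γ : All (m <_) γ) (m<δ : All (m <_) δ) where

  avoids-++-min⁺ : Avoids⊆ γ → ValleyFree δ → BelowInit δ γ → Avoids⊆ (γ ++ m ∷ δ)
  avoids-++-min⁺ avγ vfδ δ≤γ (w , x , y , z , o , w<z , y<z , y<x) with split-⊆-++ γ o
  ... | as , bs , eq , as⊆γ , bs⊆mδ = cut as bs eq as⊆γ bs⊆mδ
    where
    m<  = All.lookup m<δ
    z≰w : z ≤ w → ⊥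
    z≰w z≤w = <-irrefl refl (<-≤-trans w<z z≤w)
    cut : ∀ as bs → w ∷ x ∷ y ∷ z ∷ [] ≡ as ++ bs → as ⊆ γ → bs ⊆ m ∷ δ → ⊥
    cut [] _ refl _ bs⊆ = vfδ (x , y , z , ∷⁻ bs⊆ , y<x , y<z)
    cut (_ ∷ []) _ refl _ (_ ∷ʳ bs⊆) = vfδ (x , y , z , bs⊆ , y<x , y<z)
    cut (_ ∷ []) _ refl _ (refl ∷ bs⊆) = <-asym y<x (m< (to∈ bs⊆))
    cut (_ ∷ _ ∷ []) _ refl as⊆ bs⊆ = z≰w (All.lookup (δ≤γ as⊆) (to∈ (∷⁻ bs⊆)))
    cut (_ ∷ _ ∷ _ ∷ []) _ refl as⊆ (_ ∷ʳ bs⊆) =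
      z≰w (All.lookup (δ≤γ (⊆-trans (refl ∷ refl ∷ y ∷ʳ []) as⊆)) (to∈ bs⊆))
    cut (_ ∷ _ ∷ _ ∷ []) _ refl as⊆ (refl ∷ _) = <-asym y<z (All.lookup m<γ (to∈ (∷ˡ⁻ (∷ˡ⁻ as⊆))))
    cut (_ ∷ _ ∷ _ ∷ _ ∷ []) _ refl as⊆ _ = avγ (w , x , y , z , as⊆ , w<z , y<z , y<x)
    cut (_ ∷ _ ∷ _ ∷ _ ∷ _ ∷ _) _ () _ _

  avoids-++-min⁻ : Avoids⊆ (γ ++ m ∷ δ) → Avoids⊆ γ × ValleyFree δ × BelowInit δ γ
  avoids-++-min⁻ av = avoids⊆-mono (++⁺ʳ _ ⊆-refl) av , vfδ , δ≤γ
    where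
    vfδ : ValleyFree δ
    vfδ (x , y , z , v , y<x , y<z) =
      av (m , x , y , z , ++⁺ˡ γ (refl ∷ v) , All.lookup m<δ (to∈ (∷ˡ⁻ (∷ˡ⁻ v))) , y<z , y<x)
    δ≤γ : BelowInit δ γ
    δ≤γ {w} {x} wx⊆γ = All.tabulate λ {z} z∈δ → ≮⇒≥ λ w<z →
      av (w , x , m , z , ++⁺ wx⊆γ (refl ∷ from∈ z∈δ) , w<z , All.lookup m<δ z∈δ ,
          All.lookup m<γ (to∈ (∷ˡ⁻ wx⊆γ)))

valleyFree-∷-min : ∀ {t δ} → All (t <_) δ → ValleyFree δ → ValleyFree (t ∷ δ)
valleyFree-∷-min t<δ vf (x , y , z , _ ∷ʳ v , p) = vf (x , y , z , v , p)
valleyFree-∷-min t<δ vf (x , y , z , refl ∷ v , y<t , _) = <-asym y<t (All.lookup t<δ (to∈ v))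

valleyFree-∷ʳ-min : ∀ {t} δ → All (t <_) δ → ValleyFree δ → ValleyFree (δ ++ t ∷ [])
valleyFree-∷ʳ-min {t} δ t<δ vf (x , y , z , v , y<x , y<z) with split-⊆-++ δ v
... | as , bs , eq , as⊆ , bs⊆ = cut as bs eq as⊆ bs⊆
  where
  cut : ∀ as bs → x ∷ y ∷ z ∷ [] ≡ as ++ bs → as ⊆ δ → bs ⊆ t ∷ [] → ⊥
  cut (_ ∷ _ ∷ _ ∷ []) _ refl as⊆ _ = vf (x , y , z , as⊆ , y<x , y<z)
  cut (_ ∷ _ ∷ []) _ refl as⊆ (refl ∷ _) = <-asym y<z (All.lookup t<δ (to∈ (∷ˡ⁻ as⊆)))
  cut (_ ∷ _ ∷ []) _ refl _ (_ ∷ʳ ())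
  cut (_ ∷ []) _ refl _ (_ ∷ʳ ())
  cut (_ ∷ []) _ refl _ (refl ∷ ())
  cut [] _ refl _ (_ ∷ʳ ())
  cut [] _ refl _ (refl ∷ ())
  cut (_ ∷ _ ∷ _ ∷ _ ∷ _) _ () _ _

avoids-∷ʳ-min : ∀ {t} γ → All (t <_) γ → Avoids⊆ γ → Avoids⊆ (γ ++ t ∷ [])
avoids-∷ʳ-min γ t<γ av = avoids-++-min⁺ t<γ [] av valleyFree-[] λ _ → []

min-at-end : ∀ {t} l r → All (t <_) l → All (t <_) r → ValleyFree (l ++ t ∷ r) → l ≡ [] ⊎ r ≡ []
min-at-end []      r       _         _         _  = inj₁ refl
min-at-end (_ ∷ _) []      _         _         _  = inj₂ refl
min-at-end (x ∷ l) (z ∷ r) (t<x ∷ _) (t<z ∷ _) vf =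
  ⊥-elim (vf (x , _ , z , ++⁺ (refl ∷ minimum l) (refl ∷ refl ∷ minimum r) , t<x , t<z))

≤-<⇒[] : ∀ {t δ} → All (_≤ t) δ → All (t <_) δ → δ ≡ []
≤-<⇒[] []          []          = refl
≤-<⇒[] (z≤t ∷ _) (t<z ∷ _) = ⊥-elim (<-irrefl refl (<-≤-trans t<z z≤t))

belowInit⇒last : ∀ {t δ} l r → δ ≢ [] → All (t <_) δ → BelowInit δ (l ++ t ∷ r) → r ≡ []
belowInit⇒last l []      _    _   _   = refl
belowInit⇒last l (x ∷ r) δ≢[] t<δ δ≤γ = ⊥-elim (δ≢[] (≤-<⇒[] (δ≤γ (++⁺ˡ l (refl ∷ refl ∷ minimum r))) t<δ))

pair⊆∷ʳ⇒∈ : ∀ γ {w x t : ℕ} → w ∷ x ∷ [] ⊆ γ ++ t ∷ [] → w ∈ γ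
pair⊆∷ʳ⇒∈ []      (_ ∷ʳ ())
pair⊆∷ʳ⇒∈ []      (refl ∷ ())
pair⊆∷ʳ⇒∈ (_ ∷ γ) (_ ∷ʳ wx⊆) = there (pair⊆∷ʳ⇒∈ γ wx⊆)
pair⊆∷ʳ⇒∈ (_ ∷ γ) (refl ∷ _) = here refl

module _ {t : ℕ} {T : List ℕ} where

  ↭-consδ : ∀ γ δ → γ ++ δ ↭ T → γ ++ t ∷ δ ↭ t ∷ T
  ↭-consδ γ δ p = ↭-trans (shift t γ δ) (prep t p)

  ↭-consδ⁻ : ∀ γ δ → γ ++ t ∷ δ ↭ t ∷ T → γ ++ δ ↭ T
  ↭-consδ⁻ γ δ = drop-mid γ []

  ↭-snocδ : ∀ γ δ → γ ++ δ ↭ T → γ ++ (δ ++ t ∷ []) ↭ t ∷ T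
  ↭-snocδ γ δ p = ↭-trans (↭-reflexive (sym (++-assoc γ δ _)))
                    (↭-consδ (γ ++ δ) [] (↭-trans (↭-reflexive (++-identityʳ _)) p))

  ↭-snocδ⁻ : ∀ γ δ → γ ++ (δ ++ t ∷ []) ↭ t ∷ T → γ ++ δ ↭ T
  ↭-snocδ⁻ γ δ p = ↭-trans (↭-reflexive (sym (++-identityʳ _)))
                     (↭-consδ⁻ (γ ++ δ) [] (↭-trans (↭-reflexive (++-assoc γ δ _)) p))

  ↭-snocγ : ∀ γ δ → γ ++ δ ↭ T → (γ ++ t ∷ []) ++ δ ↭ t ∷ T
  ↭-snocγ γ δ p = ↭-trans (↭-reflexive (++-assoc γ _ δ)) (↭-consδ γ δ p)

  ↭-snocγ⁻ : ∀ γ δ → (γ ++ t ∷ []) ++ δ ↭ t ∷ T → γ ++ δ ↭ T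
  ↭-snocγ⁻ γ δ p = ↭-consδ⁻ γ δ (↭-trans (↭-reflexive (sym (++-assoc γ _ δ))) p)

All-++-↭ : ∀ {P : ℕ → Set} γ {δ T} → γ ++ δ ↭ T → All P T → All P γ × All P δ
All-++-↭ γ p PT = All.++⁻ γ (All-resp-↭ (↭-sym p) PT)

++-∷-≢[] : ∀ {A : Set} (xs : List A) {x} → xs ++ x ∷ [] ≢ []
++-∷-≢[] []      ()
++-∷-≢[] (_ ∷ _) ()

Split : Set
Split = List ℕ × List ℕ

join : ℕ → Split → List ℕ
join m (γ , δ) = γ ++ m ∷ δ

consδ snocδ snocγ : ℕ → Split → Split
consδ t (γ , δ) = γ , t ∷ δ
snocδ t (γ , δ) = γ , δ ++ t ∷ []
snocγ t (γ , δ) = γ ++ t ∷ [] , δ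

Ascending : List ℕ → Set
Ascending = AllPairs _<_

IsAvoider : List ℕ → List ℕ → Set
IsAvoider T π = π ↭ T × Avoids⊆ π

IsSplit : List ℕ → Split → Set
IsSplit T (γ , δ) = γ ++ δ ↭ T × Avoids⊆ γ × ValleyFree δ × BelowInit δ γ

IsTightSplit : List ℕ → Split → Set
IsTightSplit T (γ , δ) = γ ++ δ ↭ T × Avoids⊆ γ × ValleyFree δ × BelowAll δ γ

NonEmptyδ : Split → Set
NonEmptyδ (_ , δ) = δ ≢ []

-- The minimum t of t ∷ T sits at an end of δ, or at the end of γ when δ ≠ [], and in
-- the latter case removing it leaves a tight split.
mutual
  avoiders : List ℕ → List (List ℕ)
  avoiders []      = [] ∷ []
  avoiders (m ∷ T) = map (join m) (splits T)

  splits : List ℕ → List Split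
  splits T = map (_, []) (avoiders T) ++ splits⁺ T

  splits⁺ : List ℕ → List Split
  splits⁺ []      = []
  splits⁺ (t ∷ T) =
    (map (consδ t) (splits T) ++ map (snocδ t) (splits⁺ T)) ++ map (snocγ t) (tightSplits⁺ T)

  tightSplits : List ℕ → List Split
  tightSplits T = map (_, []) (avoiders T) ++ tightSplits⁺ T

  tightSplits⁺ : List ℕ → List Split
  tightSplits⁺ []      = []
  tightSplits⁺ (t ∷ T) = map (consδ t) (tightSplits T) ++ map (snocδ t) (tightSplits⁺ T)

module _ {T : List ℕ} where

  isSplit-noδ : ∀ {γ} → IsAvoider T γ → IsSplit T (γ , [])
  isSplit-noδ {γ} (p , av) = ↭-trans (↭-reflexive (++-identityʳ γ)) p , av , valleyFree-[] , λ _ → []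

  isTightSplit-noδ : ∀ {γ} → IsAvoider T γ → IsTightSplit T (γ , [])
  isTightSplit-noδ {γ} (p , av) = ↭-trans (↭-reflexive (++-identityʳ γ)) p , av , valleyFree-[] , λ _ → []

module _ {t : ℕ} {T : List ℕ} (t<T : All (t <_) T) where

  isAvoider-join : ∀ {p} → IsSplit T p → IsAvoider (t ∷ T) (join t p)
  isAvoider-join {γ , δ} (p , av , vf , δ≤γ) with All-++-↭ γ p t<T
  ... | t<γ , t<δ = ↭-consδ γ δ p , avoids-++-min⁺ t<γ t<δ av vf δ≤γ

  isSplit⁺-consδ : ∀ {p} → IsSplit T p → IsSplit (t ∷ T) (consδ t p) × NonEmptyδ (consδ t p)
  isSplit⁺-consδ {γ , δ} (p , av , vf , δ≤γ) with All-++-↭ γ p t<T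
  ... | t<γ , t<δ =
    (↭-consδ γ δ p , av , valleyFree-∷-min t<δ vf , λ wx⊆ → <⇒≤ (All.lookup t<γ (to∈ wx⊆)) ∷ δ≤γ wx⊆) , λ ()

  isSplit⁺-snocδ : ∀ {p} → IsSplit T p → IsSplit (t ∷ T) (snocδ t p) × NonEmptyδ (snocδ t p)
  isSplit⁺-snocδ {γ , δ} (p , av , vf , δ≤γ) with All-++-↭ γ p t<T
  ... | t<γ , t<δ =
    (↭-snocδ γ δ p , av , valleyFree-∷ʳ-min δ t<δ vf ,
     λ wx⊆ → All.++⁺ (δ≤γ wx⊆) (<⇒≤ (All.lookup t<γ (to∈ wx⊆)) ∷ [])) , ++-∷-≢[] δ

  isSplit⁺-snocγ : ∀ {p} → IsTightSplit T p × NonEmptyδ p → IsSplit (t ∷ T) (snocγ t p) × NonEmptyδ (snocγ t p)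
  isSplit⁺-snocγ {γ , δ} ((p , av , vf , δ≤γ) , δ≢[]) with All-++-↭ γ p t<T
  ... | t<γ , t<δ = (↭-snocγ γ δ p , avoids-∷ʳ-min γ t<γ av , vf , δ≤γ ∘ pair⊆∷ʳ⇒∈ γ) , δ≢[]

  isTightSplit⁺-consδ : ∀ {p} → IsTightSplit T p → IsTightSplit (t ∷ T) (consδ t p) × NonEmptyδ (consδ t p)
  isTightSplit⁺-consδ {γ , δ} (p , av , vf , δ≤γ) with All-++-↭ γ p t<T
  ... | t<γ , t<δ =
    (↭-consδ γ δ p , av , valleyFree-∷-min t<δ vf , λ w∈ → <⇒≤ (All.lookup t<γ w∈) ∷ δ≤γ w∈) , λ ()

  isTightSplit⁺-snocδ : ∀ {p} → IsTightSplit T p → IsTightSplit (t ∷ T) (snocδ t p) × NonEmptyδ (snocδ t p)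
  isTightSplit⁺-snocδ {γ , δ} (p , av , vf , δ≤γ) with All-++-↭ γ p t<T
  ... | t<γ , t<δ =
    (↭-snocδ γ δ p , av , valleyFree-∷ʳ-min δ t<δ vf ,
     λ w∈ → All.++⁺ (δ≤γ w∈) (<⇒≤ (All.lookup t<γ w∈) ∷ [])) , ++-∷-≢[] δ

mutual
  avoiders-sound : ∀ {T} → Ascending T → All (IsAvoider T) (avoiders T)
  avoiders-sound {[]}    []          = (↭-refl , avoids⊆-[]) ∷ []
  avoiders-sound {m ∷ T} (m<T ∷ T↑) = All.map⁺ (All.map (isAvoider-join m<T) (splits-sound T↑))

  splits-sound : ∀ {T} → Ascending T → All (IsSplit T) (splits T)
  splits-sound T↑ =
    All.++⁺ (All.map⁺ (All.map isSplit-noδ (avoiders-sound T↑))) (All.map proj₁ (splits⁺-sound T↑))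

  splits⁺-sound : ∀ {T} → Ascending T → All (λ p → IsSplit T p × NonEmptyδ p) (splits⁺ T)
  splits⁺-sound {[]}    []          = []
  splits⁺-sound {t ∷ T} (t<T ∷ T↑) =
    All.++⁺ (All.++⁺ (All.map⁺ (All.map (isSplit⁺-consδ t<T) (splits-sound T↑)))
                     (All.map⁺ (All.map (isSplit⁺-snocδ t<T ∘ proj₁) (splits⁺-sound T↑))))
            (All.map⁺ (All.map (isSplit⁺-snocγ t<T) (tightSplits⁺-sound T↑)))

  tightSplits-sound : ∀ {T} → Ascending T → All (IsTightSplit T) (tightSplits T)
  tightSplits-sound T↑ =
    All.++⁺ (All.map⁺ (All.map isTightSplit-noδ (avoiders-sound T↑))) (All.map proj₁ (tightSplits⁺-sound T↑))

  tightSplits⁺-sound : ∀ {T} → Ascending T → All (λ p → IsTightSplit T p × NonEmptyδ p) (tightSplits⁺ T)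
  tightSplits⁺-sound {[]}    []          = []
  tightSplits⁺-sound {t ∷ T} (t<T ∷ T↑) =
    All.++⁺ (All.map⁺ (All.map (isTightSplit⁺-consδ t<T) (tightSplits-sound T↑)))
            (All.map⁺ (All.map (isTightSplit⁺-snocδ t<T ∘ proj₁) (tightSplits⁺-sound T↑)))

data MinAtEnd (t : ℕ) : List ℕ → Set where
  atFront : ∀ r → MinAtEnd t (t ∷ r)
  atBack  : ∀ l → l ≢ [] → MinAtEnd t (l ++ t ∷ [])

module _ {t : ℕ} {T : List ℕ} (t<T : All (t <_) T) where

  minAtEnd : ∀ γ δ → γ ++ δ ↭ t ∷ T → ValleyFree δ → t ∈ δ → MinAtEnd t δ
  minAtEnd γ δ p vf t∈δ with ∈-∃++ t∈δ
  ... | []    , r , refl = atFront r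
  ... | x ∷ l , r , refl
    with All-++-↭ (γ ++ x ∷ l) (↭-consδ⁻ (γ ++ x ∷ l) r (subst (_↭ _) (sym (++-assoc γ (x ∷ l) _)) p)) t<T
  ... | t<γxl , t<r with min-at-end (x ∷ l) r (proj₂ (All.++⁻ γ t<γxl)) t<r vf
  ...   | inj₁ ()
  ...   | inj₂ refl = atBack (x ∷ l) λ ()

  δ-above-min : ∀ {δ} l r → (l ++ t ∷ r) ++ δ ↭ t ∷ T → All (t <_) δ
  δ-above-min {δ} l r p =
    proj₂ (All.++⁻ r (proj₂ (All-++-↭ l (↭-consδ⁻ l (r ++ δ) (subst (_↭ _) (++-assoc l (t ∷ r) δ) p)) t<T)))

module _ {t : ℕ} {T : List ℕ} where

  isSplit-consδ⁻ : ∀ γ r → IsSplit (t ∷ T) (γ , t ∷ r) → IsSplit T (γ , r)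
  isSplit-consδ⁻ γ r (p , av , vf , δ≤γ) =
    ↭-consδ⁻ γ r p , av , valleyFree-mono (t ∷ʳ ⊆-refl) vf , λ wx⊆ → All.tail (δ≤γ wx⊆)

  isSplit-snocδ⁻ : ∀ γ l → IsSplit (t ∷ T) (γ , l ++ t ∷ []) → IsSplit T (γ , l)
  isSplit-snocδ⁻ γ l (p , av , vf , δ≤γ) =
    ↭-snocδ⁻ γ l p , av , valleyFree-mono (++⁺ʳ _ ⊆-refl) vf , λ wx⊆ → proj₁ (All.++⁻ l (δ≤γ wx⊆))

  isSplit-snocγ⁻ : ∀ l δ → IsSplit (t ∷ T) (l ++ t ∷ [] , δ) → IsTightSplit T (l , δ)
  isSplit-snocγ⁻ l δ (p , av , vf , δ≤γ) =
    ↭-snocγ⁻ l δ p , avoids⊆-mono (++⁺ʳ _ ⊆-refl) av , vf , λ w∈l → δ≤γ (++⁺ (from∈ w∈l) (refl ∷ []))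

  isTightSplit-consδ⁻ : ∀ γ r → IsTightSplit (t ∷ T) (γ , t ∷ r) → IsTightSplit T (γ , r)
  isTightSplit-consδ⁻ γ r (p , av , vf , δ≤γ) =
    ↭-consδ⁻ γ r p , av , valleyFree-mono (t ∷ʳ ⊆-refl) vf , λ w∈ → All.tail (δ≤γ w∈)

  isTightSplit-snocδ⁻ : ∀ γ l → IsTightSplit (t ∷ T) (γ , l ++ t ∷ []) → IsTightSplit T (γ , l)
  isTightSplit-snocδ⁻ γ l (p , av , vf , δ≤γ) =
    ↭-snocδ⁻ γ l p , av , valleyFree-mono (++⁺ʳ _ ⊆-refl) vf , λ w∈ → proj₁ (All.++⁻ l (δ≤γ w∈))

↭-noδ : ∀ {γ T : List ℕ} → γ ++ [] ↭ T → γ ↭ T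
↭-noδ {γ} = ↭-trans (↭-reflexive (sym (++-identityʳ γ)))

min∈γ⊎δ : ∀ {t : ℕ} {T} (γ δ : List ℕ) → γ ++ δ ↭ t ∷ T → t ∈ γ ⊎ t ∈ δ
min∈γ⊎δ γ δ p = ∈-++⁻ γ (∈-resp-↭ (↭-sym p) (here refl))

mutual
  avoiders-complete : ∀ {T} → Ascending T → ∀ {π} → IsAvoider T π → π ∈ avoiders T
  avoiders-complete {[]} [] (p , _) with ↭-empty-inv p
  ... | refl = here refl
  avoiders-complete {m ∷ T} (m<T ∷ T↑) (p , av) with ∈-∃++ (∈-resp-↭ (↭-sym p) (here refl))
  ... | γ , δ , refl with All-++-↭ γ (↭-consδ⁻ γ δ p) m<T
  ... | m<γ , m<δ =
    ∈-map⁺ (join m) (splits-complete T↑ (↭-consδ⁻ γ δ p , avoids-++-min⁻ m<γ m<δ av))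

  splits-complete : ∀ {T} → Ascending T → ∀ {p} → IsSplit T p → p ∈ splits T
  splits-complete T↑ {γ , []} (p , av , _) = ∈-++⁺ˡ (∈-map⁺ (_, []) (avoiders-complete T↑ (↭-noδ p , av)))
  splits-complete T↑ {γ , _ ∷ _} s = ∈-++⁺ʳ _ (splits⁺-complete T↑ (s , λ ()))

  splits⁺-complete : ∀ {T} → Ascending T → ∀ {p} → IsSplit T p × NonEmptyδ p → p ∈ splits⁺ T
  splits⁺-complete {[]} [] {γ , δ} ((p , _) , δ≢[]) = ⊥-elim (δ≢[] (++-conicalʳ γ δ (↭-empty-inv p)))
  splits⁺-complete {t ∷ T} (t<T ∷ T↑) {γ , δ} (s@(p , _ , vf , δ≤γ) , δ≢[]) with min∈γ⊎δ γ δ p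
  ... | inj₂ t∈δ with minAtEnd t<T γ δ p vf t∈δ
  ...   | atFront r = ∈-++⁺ˡ (∈-++⁺ˡ (∈-map⁺ (consδ t) (splits-complete T↑ (isSplit-consδ⁻ γ r s))))
  ...   | atBack l l≢[] =
    ∈-++⁺ˡ (∈-++⁺ʳ (map (consδ t) (splits T)) (∈-map⁺ (snocδ t) (splits⁺-complete T↑ (isSplit-snocδ⁻ γ l s , l≢[]))))
  splits⁺-complete {t ∷ T} (t<T ∷ T↑) {γ , δ} (s@(p , _ , _ , δ≤γ) , δ≢[]) | inj₁ t∈γ with ∈-∃++ t∈γ
  ... | l , r , refl with belowInit⇒last l r δ≢[] (δ-above-min t<T l r p) δ≤γ
  ...   | refl = ∈-++⁺ʳ _ (∈-map⁺ (snocγ t) (tightSplits⁺-complete T↑ (isSplit-snocγ⁻ l δ s , δ≢[])))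

  tightSplits-complete : ∀ {T} → Ascending T → ∀ {p} → IsTightSplit T p → p ∈ tightSplits T
  tightSplits-complete T↑ {γ , []} (p , av , _) = ∈-++⁺ˡ (∈-map⁺ (_, []) (avoiders-complete T↑ (↭-noδ p , av)))
  tightSplits-complete T↑ {γ , _ ∷ _} s = ∈-++⁺ʳ _ (tightSplits⁺-complete T↑ (s , λ ()))

  tightSplits⁺-complete : ∀ {T} → Ascending T → ∀ {p} → IsTightSplit T p × NonEmptyδ p → p ∈ tightSplits⁺ T
  tightSplits⁺-complete {[]} [] {γ , δ} ((p , _) , δ≢[]) = ⊥-elim (δ≢[] (++-conicalʳ γ δ (↭-empty-inv p)))
  tightSplits⁺-complete {t ∷ T} (t<T ∷ T↑) {γ , δ} (s@(p , _ , vf , δ≤γ) , δ≢[]) with min∈γ⊎δ γ δ p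
  ... | inj₂ t∈δ with minAtEnd t<T γ δ p vf t∈δ
  ...   | atFront r = ∈-++⁺ˡ (∈-map⁺ (consδ t) (tightSplits-complete T↑ (isTightSplit-consδ⁻ γ r s)))
  ...   | atBack l l≢[] = ∈-++⁺ʳ _ (∈-map⁺ (snocδ t) (tightSplits⁺-complete T↑ (isTightSplit-snocδ⁻ γ l s , l≢[])))
  tightSplits⁺-complete {t ∷ T} (t<T ∷ T↑) {γ , δ} ((p , _ , _ , δ≤γ) , δ≢[]) | inj₁ t∈γ with ∈-∃++ t∈γ
  ... | l , r , refl = ⊥-elim (δ≢[] (≤-<⇒[] (δ≤γ t∈γ) (δ-above-min t<T l r p)))

module _ {A B : Set} where

  Unique-map⁺-on : ∀ {P : A → Set} {f : A → B} {xs} →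
    (∀ {x y} → P x → P y → f x ≡ f y → x ≡ y) → All P xs → Unique xs → Unique (map f xs)
  Unique-map⁺-on inj []         []         = []
  Unique-map⁺-on inj (px ∷ pxs) (x∉ ∷ xs!) =
    All.map⁺ (All.zipWith (λ (py , x≢y) → x≢y ∘ inj px py) (pxs , x∉)) ∷ Unique-map⁺-on inj pxs xs!

Disjoint-separated : ∀ {A : Set} {P : A → Set} {xs ys} → All P xs → All (¬_ ∘ P) ys → Disjoint xs ys
Disjoint-separated Pxs ¬Pys (v∈xs , v∈ys) = All.lookup ¬Pys v∈ys (All.lookup Pxs v∈xs)

++-∷-injective : ∀ {m : ℕ} γ₁ γ₂ {δ₁ δ₂} → m ∉ γ₁ → m ∉ γ₂ →
  γ₁ ++ m ∷ δ₁ ≡ γ₂ ++ m ∷ δ₂ → γ₁ ≡ γ₂ × δ₁ ≡ δ₂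
++-∷-injective []       []       _   _   refl = refl , refl
++-∷-injective []       (_ ∷ _)  _   m∉₂ refl = ⊥-elim (m∉₂ (here refl))
++-∷-injective (_ ∷ _)  []       m∉₁ _   refl = ⊥-elim (m∉₁ (here refl))
++-∷-injective (x ∷ γ₁) (y ∷ γ₂) m∉₁ m∉₂ eq with ∷-injective eq
... | refl , eq′ with ++-∷-injective γ₁ γ₂ (m∉₁ ∘ there) (m∉₂ ∘ there) eq′
...   | refl , refl = refl , refl

join-injective : ∀ m {p q} → m ∉ proj₁ p → m ∉ proj₁ q → join m p ≡ join m q → p ≡ q
join-injective m {γ₁ , _} {γ₂ , _} m∉₁ m∉₂ eq with ++-∷-injective γ₁ γ₂ m∉₁ m∉₂ eq
... | refl , refl = refl

module _ {t : ℕ} where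

  consδ-injective : ∀ {p q} → consδ t p ≡ consδ t q → p ≡ q
  consδ-injective {_ , _} {_ , _} refl = refl

  snocδ-injective : ∀ {p q} → snocδ t p ≡ snocδ t q → p ≡ q
  snocδ-injective {_ , δ₁} {_ , δ₂} eq = cong₂ _,_ (cong proj₁ eq) (∷ʳ-injectiveˡ δ₁ δ₂ (cong proj₂ eq))

  snocγ-injective : ∀ {p q} → snocγ t p ≡ snocγ t q → p ≡ q
  snocγ-injective {γ₁ , _} {γ₂ , _} eq = cong₂ _,_ (∷ʳ-injectiveˡ γ₁ γ₂ (cong proj₁ eq)) (cong proj₂ eq)

module _ {t : ℕ} {T : List ℕ} (t<T : All (t <_) T) where

  min∉γ : ∀ {γ δ} → γ ++ δ ↭ T → t ∉ γ
  min∉γ {γ} p t∈γ = <-irrefl refl (All.lookup (proj₁ (All-++-↭ γ p t<T)) t∈γ)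

  min∉head-snocδ : ∀ {γ δ} → γ ++ δ ↭ T → δ ≢ [] → head (δ ++ t ∷ []) ≢ just t
  min∉head-snocδ {γ} {[]}    _ δ≢[] = ⊥-elim (δ≢[] refl)
  min∉head-snocδ {γ} {_ ∷ _} p _ refl with proj₂ (All-++-↭ γ p t<T)
  ... | t<t ∷ _ = <-irrefl refl t<t

  consδ-snocδ-disjoint : ∀ {ps qs} {P : Split → Set} →
    All (λ q → (proj₁ q ++ proj₂ q ↭ T × P q) × NonEmptyδ q) qs →
    Disjoint (map (consδ t) ps) (map (snocδ t) qs)
  consδ-snocδ-disjoint qs-sound =
    Disjoint-separated {P = λ p → head (proj₂ p) ≡ just t} (All.map⁺ (All.universal (λ _ → refl) _))
      (All.map⁺ (All.map (λ ((p , _) , δ≢[]) → min∉head-snocδ p δ≢[]) qs-sound))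

noδ-disjoint : ∀ {γs ps} → All NonEmptyδ ps → Disjoint (map (_, []) γs) ps
noδ-disjoint = Disjoint-separated {P = λ p → proj₂ p ≡ []} (All.map⁺ (All.universal (λ _ → refl) _))

min∈-snocγ : ∀ {t : ℕ} p → t ∈ proj₁ (snocγ t p)
min∈-snocγ (γ , _) = ∈-++⁺ʳ γ (here refl)

mutual
  avoiders-unique : ∀ {T} → Ascending T → Unique (avoiders T)
  avoiders-unique {[]}    []          = [] ∷ []
  avoiders-unique {m ∷ T} (m<T ∷ T↑) =
    Unique-map⁺-on (join-injective m) (All.map (min∉γ m<T ∘ proj₁) (splits-sound T↑)) (splits-unique T↑)

  splits-unique : ∀ {T} → Ascending T → Unique (splits T)
  splits-unique T↑ =
    Unique.++⁺ (Unique.map⁺ (cong proj₁) (avoiders-unique T↑)) (splits⁺-unique T↑)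
      (noδ-disjoint (All.map proj₂ (splits⁺-sound T↑)))

  splits⁺-unique : ∀ {T} → Ascending T → Unique (splits⁺ T)
  splits⁺-unique {[]}    []          = []
  splits⁺-unique {t ∷ T} (t<T ∷ T↑) =
    Unique.++⁺
      (Unique.++⁺ (Unique.map⁺ consδ-injective (splits-unique T↑))
                  (Unique.map⁺ snocδ-injective (splits⁺-unique T↑))
        (consδ-snocδ-disjoint t<T (splits⁺-sound T↑)))
      (Unique.map⁺ snocγ-injective (tightSplits⁺-unique T↑))
      (Disjoint-separated {P = λ p → t ∉ proj₁ p}
        (All.++⁺ (All.map⁺ (All.map (min∉γ t<T ∘ proj₁) (splits-sound T↑)))
                 (All.map⁺ (All.map (min∉γ t<T ∘ proj₁ ∘ proj₁) (splits⁺-sound T↑))))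
        (All.map⁺ (All.universal (λ p t∉ → t∉ (min∈-snocγ p)) _)))

  tightSplits-unique : ∀ {T} → Ascending T → Unique (tightSplits T)
  tightSplits-unique T↑ =
    Unique.++⁺ (Unique.map⁺ (cong proj₁) (avoiders-unique T↑)) (tightSplits⁺-unique T↑)
      (noδ-disjoint (All.map proj₂ (tightSplits⁺-sound T↑)))

  tightSplits⁺-unique : ∀ {T} → Ascending T → Unique (tightSplits⁺ T)
  tightSplits⁺-unique {[]}    []          = []
  tightSplits⁺-unique {t ∷ T} (t<T ∷ T↑) =
    Unique.++⁺ (Unique.map⁺ consδ-injective (tightSplits-unique T↑))
               (Unique.map⁺ snocδ-injective (tightSplits⁺-unique T↑))
      (consδ-snocδ-disjoint t<T (tightSplits⁺-sound T↑))

open import Data.Nat using (_+_; _*_; _^_)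

mutual
  #avoiders : ℕ → ℕ
  #avoiders zero    = 1
  #avoiders (suc n) = #avoiders n + #splits⁺ n

  #splits⁺ : ℕ → ℕ
  #splits⁺ zero    = 0
  #splits⁺ (suc n) = ((#avoiders n + #splits⁺ n) + #splits⁺ n) + #tightSplits⁺ n

  #tightSplits⁺ : ℕ → ℕ
  #tightSplits⁺ zero    = 0
  #tightSplits⁺ (suc n) = (#avoiders n + #tightSplits⁺ n) + #tightSplits⁺ n

mutual
  length-avoiders : ∀ T → length (avoiders T) ≡ #avoiders (length T)
  length-avoiders []      = refl
  length-avoiders (m ∷ T) = trans (length-map (join m) (splits T)) (length-splits T)

  length-splits : ∀ T → length (splits T) ≡ #avoiders (length T) + #splits⁺ (length T)
  length-splits T = trans (length-++ (map (_, []) (avoiders T)))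
    (cong₂ _+_ (trans (length-map _ (avoiders T)) (length-avoiders T)) (length-splits⁺ T))

  length-splits⁺ : ∀ T → length (splits⁺ T) ≡ #splits⁺ (length T)
  length-splits⁺ []      = refl
  length-splits⁺ (t ∷ T) =
    trans (length-++ (map (consδ t) (splits T) ++ map (snocδ t) (splits⁺ T)))
      (cong₂ _+_
        (trans (length-++ (map (consδ t) (splits T)))
          (cong₂ _+_ (trans (length-map _ (splits T)) (length-splits T))
                     (trans (length-map _ (splits⁺ T)) (length-splits⁺ T))))
        (trans (length-map _ (tightSplits⁺ T)) (length-tightSplits⁺ T)))

  length-tightSplits : ∀ T → length (tightSplits T) ≡ #avoiders (length T) + #tightSplits⁺ (length T)
  length-tightSplits T = trans (length-++ (map (_, []) (avoiders T)))
    (cong₂ _+_ (trans (length-map _ (avoiders T)) (length-avoiders T)) (length-tightSplits⁺ T))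

  length-tightSplits⁺ : ∀ T → length (tightSplits⁺ T) ≡ #tightSplits⁺ (length T)
  length-tightSplits⁺ []      = refl
  length-tightSplits⁺ (t ∷ T) =
    trans (length-++ (map (consδ t) (tightSplits T)))
      (cong₂ _+_ (trans (length-map _ (tightSplits T)) (length-tightSplits T))
                 (trans (length-map _ (tightSplits⁺ T)) (length-tightSplits⁺ T)))

#avoiders+#tightSplits⁺≡1+#splits⁺ : ∀ n → #avoiders n + #tightSplits⁺ n ≡ suc (#splits⁺ n)
#avoiders+#tightSplits⁺≡1+#splits⁺ zero    = refl
#avoiders+#tightSplits⁺≡1+#splits⁺ (suc n) =
  step (#avoiders n) (#splits⁺ n) (#tightSplits⁺ n) (#avoiders+#tightSplits⁺≡1+#splits⁺ n)
  where
  step : ∀ a s x → a + x ≡ suc s → (a + s) + ((a + x) + x) ≡ suc (((a + s) + s) + x)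
  step a s x eq = begin
    (a + s) + ((a + x) + x)   ≡⟨ ℕ-Solver.solve (a List.∷ s List.∷ x List.∷ List.[]) ⟩
    2 * (a + x) + s           ≡⟨ cong (λ u → 2 * u + s) eq ⟩
    2 * suc s + s             ≡⟨ ℕ-Solver.solve (s List.∷ List.[]) ⟩
    suc (suc s + 2 * s)       ≡⟨ cong (λ u → suc (u + 2 * s)) eq ⟨
    suc ((a + x) + 2 * s)     ≡⟨ ℕ-Solver.solve (a List.∷ s List.∷ x List.∷ List.[]) ⟩
    suc (((a + s) + s) + x)   ∎

#splits⁺-suc : ∀ n → #splits⁺ (suc n) ≡ 3 * #splits⁺ n + 1
#splits⁺-suc n =
  step (#avoiders n) (#splits⁺ n) (#tightSplits⁺ n) (#avoiders+#tightSplits⁺≡1+#splits⁺ n)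
  where
  step : ∀ a s x → a + x ≡ suc s → ((a + s) + s) + x ≡ 3 * s + 1
  step a s x eq = begin
    ((a + s) + s) + x   ≡⟨ ℕ-Solver.solve (a List.∷ s List.∷ x List.∷ List.[]) ⟩
    (a + x) + 2 * s     ≡⟨ cong (_+ 2 * s) eq ⟩
    suc s + 2 * s       ≡⟨ ℕ-Solver.solve (s List.∷ List.[]) ⟩
    3 * s + 1           ∎

#avoiders-rec : ∀ n → #avoiders (suc (suc n)) + 3 * #avoiders n ≡ 4 * #avoiders (suc n) + 1
#avoiders-rec n = step (#avoiders n) (#splits⁺ n) (#splits⁺ (suc n)) (#splits⁺-suc n)
  where
  step : ∀ a s s′ → s′ ≡ 3 * s + 1 → (a + s) + s′ + 3 * a ≡ 4 * (a + s) + 1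
  step a s s′ refl = ℕ-Solver.solve (a List.∷ s List.∷ List.[])

#avoiders-generating-function : ∀ k →
  (poly (+ 1 ∷ -[1+ 2 ] ∷ []) ⊛ (poly (+ 1 ∷ -[1+ 0 ] ∷ [])
    ⊛ (poly (+ 1 ∷ -[1+ 0 ] ∷ []) ⊛ (λ n → + #avoiders n)))) k
  ≡ (poly (+ 1 ∷ -[1+ 1 ] ∷ []) ⊛ poly (+ 1 ∷ -[1+ 1 ] ∷ [])) k
#avoiders-generating-function 0                     = refl
#avoiders-generating-function 1                     = refl
#avoiders-generating-function 2                     = refl
#avoiders-generating-function (suc (suc (suc k))) =
  trans (third-difference-vanishes {#avoiders} #avoiders-rec k)
        (sym (linear-⊛ (+ 1) -[1+ 1 ] (poly (+ 1 ∷ -[1+ 1 ] ∷ [])) (suc (suc k))))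

ascending-[_] : ∀ n → Ascending [ n ]
ascending-[ n ] = AllPairs.applyUpTo⁺₁ suc n (λ i<j _ → s≤s i<j)

listsAvoiders : ∀ n → ListsAvoiders n (avoiders [ n ])
listsAvoiders n = avoiders-unique (ascending-[ n ]) , λ π → mk⇔
  (λ π∈ → case All.lookup (avoiders-sound (ascending-[ n ])) π∈ of λ (p , av) → p , avoids⊆⇒avoids av)
  (λ (p , av) → avoiders-complete (ascending-[ n ]) (p , avoids⇒avoids⊆ av))

length-avoiders-[_] : ∀ n → length (avoiders [ n ]) ≡ #avoiders n
length-avoiders-[ n ] = trans (length-avoiders [ n ]) (cong #avoiders (length-applyUpTo suc n))

length-unique-≡ : ∀ {A : Set} {xs ys : List A} → Unique xs → Unique ys → (∀ {z} → z ∈ xs ⇔ z ∈ ys) →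
  length xs ≡ length ys
length-unique-≡ xs! ys! xs≈ys = ↭-length (∼bag⇒↭ (unique∧set⇒bag xs! ys! xs≈ys))

length-listsAvoiders : ∀ n L → ListsAvoiders n L → length L ≡ #avoiders n
length-listsAvoiders n L (L! , L≈) = begin
  length L                 ≡⟨ length-unique-≡ L! avoiders! (λ {π} → ⇔-sym (avoiders≈ π) ⇔-∘ L≈ π) ⟩
  length (avoiders [ n ])  ≡⟨ length-avoiders-[ n ] ⟩
  #avoiders n              ∎
  where
  avoiders! = proj₁ (listsAvoiders n)
  avoiders≈ = proj₂ (listsAvoiders n)

theorem13 : Σ (ℕ → ℕ) λ a →
    ((n : ℕ) → Σ (List (List ℕ)) λ L → ListsAvoiders n L × length L ≡ a n)
    × ((n : ℕ) (L : List (List ℕ)) → ListsAvoiders n L → length L ≡ a n)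
    × a 0 ≡ 1 × a 1 ≡ 1
    × ((n : ℕ) → a (suc (suc n)) + 3 * a n ≡ 4 * a (suc n) + 1)
    × ((n : ℕ) → 4 * a n + 2 * n ≡ 3 ^ n + 3)
    × ((k : ℕ) →
    (poly (+ 1 ∷ -[1+ 2 ] ∷ []) ⊛ (poly (+ 1 ∷ -[1+ 0 ] ∷ [])
    ⊛ (poly (+ 1 ∷ -[1+ 0 ] ∷ []) ⊛ (λ n → + a n)))) k
    ≡ (poly (+ 1 ∷ -[1+ 1 ] ∷ []) ⊛ poly (+ 1 ∷ -[1+ 1 ] ∷ [])) k)
theorem13 =
  #avoiders ,
  (λ n → avoiders [ n ] , listsAvoiders n , length-avoiders-[ n ]) ,
  length-listsAvoiders ,
  refl , refl ,
  #avoiders-rec ,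
  closed-form {#avoiders} refl refl #avoiders-rec ,
  #avoiders-generating-function
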